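{- Let $s,s',t_1,t_1',t_2,t_2',u_{12},u_{1'2},u_{12'},u_{1'2'}$ be states of a pLTS such that the only transitions outgoing from $s,s',u_{12},u_{1'2},u_{12'},u_{1'2'}$ are $s\xrightarrow{a}u_{12}\mid u_{1'2'}$, $s'\xrightarrow{a}u_{12'}\mid u_{1'2}$, $u_{12}\xrightarrow{a}t_1\mid t_2$, $u_{1'2'}\xrightarrow{a}t_1'\mid t_2'$, $u_{12'}\xrightarrow{a}t_1\mid t_2'$, $u_{1'2}\xrightarrow{a}t_1'\mid t_2$. Then $s\sim s'$ if and only if ($t_1\sim t_1'$ or $t_2\sim t_2'$).
   Context: A pLTS is $(S,\Sigma,\to)$ with $S$ countable, $\Sigma$ finite, and an image-finite relation $\to\subseteq S\times\Sigma\times\mathcal{D}(S)$, where $\mathcal{D}(S)$ is the set of probability distributions $d:S\to[0,1]\cap\mathbb{Q}$. Bisimilarity $\sim$: an equivalence $R$ on $S$ is a bisimulation if $s\,R\,t$ implies that for every $s\xrightarrow{a}d$ there is $t\xrightarrow{a}d'$ with $d(E)=d'(E)$ for every $R$-class $E$ (where $d(E)=\sum_{x\in E}d(x)$); $\sim$ is the union of all bisimulations. Notation: $s\xrightarrow{a}x\mid y$ abbreviates the transition $s\xrightarrow{a}\tfrac12 x+\tfrac12 y$, i.e. to the distribution assigning $\tfrac12$ to each of $x,y$ (summed if they coincide). -}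

module Defs where

open import Data.Nat as ℕ using (ℕ)
open import Data.Fin using (Fin)
open import Data.Rational using (ℚ; 0ℚ; 1ℚ; ½; _+_; _<_; _≤_)
open import Data.List using (List; foldr; map)
open import Data.List.Relation.Unary.All using (All)
open import Data.List.Relation.Unary.Unique.Propositional using (Unique)
open import Data.List.Relation.Unary.Any using (Any)
open import Data.Product using (Σ; ∃; _×_; _,_)
open import Function using (_↔_; _↣_; Injection)
open import Relation.Binary.PropositionalEquality using (_≡_)
open import Relation.Binary.Structures using (IsEquivalence)
open import Relation.Nullary using (yes; no)

sumℚ : List ℚ → ℚ
sumℚ = foldr _+_ 0ℚ

module _ {S : Set} where

  mass : (S → ℚ) → List S → ℚ
  mass d F = sumℚ (map d F)

  FinSub : (S → Set) → List S → Set
  FinSub P F = Unique F × All P F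

  -- d(P) ≤ d'(P), where d(P) = Σ_{x∈P} d(x) is the (possibly infinite) sum of a
  -- nonnegative family, i.e. the supremum of its finite subsums.
  -- sup_F d(F) ≤ sup_G d'(G)  iff  ∀ F, ∀ ε > 0, ∃ G with d(F) < d'(G) + ε.
  MassLE : (S → ℚ) → (S → ℚ) → (S → Set) → Set
  MassLE d d' P = (F : List S) → FinSub P F → (ε : ℚ) → 0ℚ < ε →
                  Σ (List S) λ G → FinSub P G × (mass d F < mass d' G + ε)

  MassEq : (S → ℚ) → (S → ℚ) → (S → Set) → Set
  MassEq d d' P = MassLE d d' P × MassLE d' d P

  -- probability distribution d : S → [0,1] ∩ ℚ with (infinite) sum 1
  IsDist : (S → ℚ) → Set
  IsDist d = ((x : S) → 0ℚ ≤ d x)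
           × ((F : List S) → Unique F → mass d F ≤ 1ℚ)
           × ((ε : ℚ) → 0ℚ < ε → Σ (List S) λ F → Unique F × (1ℚ < mass d F + ε))

record pLTS : Set₁ where
  field
    State     : Set
    Act       : Set
    countable : State ↣ ℕ
    finiteAct : Σ ℕ λ n → Act ↔ Fin n
    _⟶[_]_    : State → Act → (State → ℚ) → Set
    isDist    : ∀ {s a d} → s ⟶[ a ] d → IsDist d
    imageFinite : (s : State) (a : Act) → Σ (List (State → ℚ)) λ L →
                  ∀ d → s ⟶[ a ] d → Any (λ d' → ∀ x → d x ≡ d' x) L

  -- the distribution ½x + ½y (masses summed if x = y), using the decidable
  -- equality of S inherited from its injection into ℕ
  private
    code : State → ℕ
    code = Injection.to countable

    δ : State → State → ℚ
    δ x z with code z ℕ.≟ code x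
    ... | yes _ = ½
    ... | no  _ = 0ℚ

  half : State → State → (State → ℚ)
  half x y z = δ x z + δ y z

  -- R is a bisimulation: an equivalence such that s R t and s -a-> d imply
  -- some t -a-> d' with d(E) = d'(E) for every R-class E (= class of some e)
  IsBisimulation : (State → State → Set) → Set
  IsBisimulation R = IsEquivalence R ×
    (∀ {s t} → R s t → ∀ {a d} → s ⟶[ a ] d →
       Σ (State → ℚ) λ d' → (t ⟶[ a ] d') × ((e : State) → MassEq d d' (R e)))

  _∼_ : State → State → Set₁
  s ∼ t = Σ (State → State → Set) λ R → IsBisimulation R × R s t

  OnlyStep : State → Act → State → State → Set
  OnlyStep s a x y = ∀ b d → (s ⟶[ b ] d → (b ≡ a) × (∀ z → d z ≡ half x y z))
                           × ((b ≡ a) × (∀ z → d z ≡ half x y z) → s ⟶[ b ] d)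

-- (⇒) In a bisimulation R with s R s', the class of u₁₂ gets mass ½ from the step of s, so the
-- step of s' must put mass on it too: u₁₂ R u₁₂' or u₁₂ R u₁'₂.  The two related states then step
-- to halves sharing the target t₁ (resp. t₂), and the class of the other target can only get the
-- same mass from both sides if it contains the other primed target: t₂ R t₂' (resp. t₁ R t₁').
-- (⇐) If R is a bisimulation with t₁ R t₁', add the pairs (s, s'), (u₁₂, u₁'₂), (u₁'₂', u₁₂') and
-- close under equivalence.  The new pairs step to halves of related states; steps of R-related
-- states remain matched because each class of the closure is a union of R-classes.  The case
-- t₂ ∼ t₂' is the same square with the indices 1 and 2 exchanged.
module Submission where

open import Defs
open import Algebra.Bundles using (CommutativeMonoid)
import Algebra.Properties.CommutativeSemigroup as CommutativeSemigroupProperties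
open import Data.Empty using (⊥-elim)
open import Data.List using (List; []; _∷_; _++_; [_]; map; length; concatMap; deduplicate)
open import Data.List.Membership.Propositional using (_∈_; _∉_; find; lose)
open import Data.List.Membership.Propositional.Properties using (∈-++⁺ˡ; ∈-++⁺ʳ; ∈-deduplicate⁺)
import Data.List.Properties as List
open import Data.List.Relation.Binary.Permutation.Propositional
  using (_↭_; ↭-sym; ↭-trans; ↭-reflexive; ↭⇒↭ₛ)
import Data.List.Relation.Binary.Permutation.Propositional.Properties as ↭
import Data.List.Relation.Binary.Permutation.Setoid.Properties as ↭ₛ
open import Data.List.Relation.Unary.All as All using (All; []; _∷_)
import Data.List.Relation.Unary.All.Properties as All
open import Data.List.Relation.Unary.Any as Any using (Any; here; there)
import Data.List.Relation.Unary.Any.Properties as Any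
open import Data.List.Relation.Unary.Unique.Propositional using (Unique; []; _∷_)
import Data.List.Relation.Unary.Unique.Propositional.Properties as Unique
import Data.List.Relation.Unary.Unique.DecPropositional.Properties as UniqueDec
open import Data.Nat as ℕ using (ℕ; suc)
open import Data.Nat.Properties using (suc-injective)
open import Data.Product using (Σ; _×_; _,_; proj₁; proj₂)
open import Data.Rational using (ℚ; 0ℚ; 1ℚ; ½; _+_; _*_; _<_; _≤_)
import Data.Rational.Properties as ℚ
open import Data.Sum using (_⊎_; inj₁; inj₂)
open import Function using (_⇔_; mk⇔; _∘′_)
open import Function.Bundles using (Injection)
open import Level using (0ℓ)
open import Relation.Binary.Core using (Rel)
open import Relation.Binary.Construct.Closure.Equivalence as EqClosure using (EqClosure)
open import Relation.Binary.Construct.Closure.ReflexiveTransitive using (return)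
open import Relation.Binary.Construct.Closure.Symmetric using (fwd)
open import Relation.Binary.Construct.Union using (_∪_)
open import Relation.Binary.Definitions using (DecidableEquality)
open import Relation.Binary.PropositionalEquality
  using (_≡_; _≢_; refl; sym; trans; cong; cong₂; subst; subst₂; setoid)
open import Relation.Binary.Structures using (IsEquivalence)
open import Relation.Nullary using (yes; no)
import Relation.Nullary.Decidable as Dec

open CommutativeSemigroupProperties
  (CommutativeMonoid.commutativeSemigroup ℚ.+-0-commutativeMonoid) using (interchange)

halve : ℚ → ℚ
halve ε = ½ * ε

halve-pos : ∀ {ε} → 0ℚ < ε → 0ℚ < halve ε
halve-pos {ε} ε>0 = subst (_< halve ε) (ℚ.*-zeroʳ ½) (ℚ.*-monoʳ-<-pos ½ ε>0)

halve+halve : ∀ ε → halve ε + halve ε ≡ ε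
halve+halve ε = trans (sym (ℚ.*-distribʳ-+ ε ½ ½)) (ℚ.*-identityˡ ε)

≤⇒<+pos : ∀ {a b ε} → a ≤ b → 0ℚ < ε → a < b + ε
≤⇒<+pos {a} {b} {ε} a≤b ε>0 =
  ℚ.≤-<-trans a≤b (subst (_< b + ε) (ℚ.+-identityʳ b) (ℚ.+-monoʳ-< b ε>0))

+-mono-<-halves : ∀ {a b c d ε} → a < b + halve ε → c < d + halve ε → a + c < (b + d) + ε
+-mono-<-halves {a} {b} {c} {d} {ε} p q = subst (a + c <_) regroup (ℚ.+-mono-< p q)
  where
  regroup : (b + halve ε) + (d + halve ε) ≡ (b + d) + ε
  regroup = trans (interchange b (halve ε) d (halve ε)) (cong (b + d +_) (halve+halve ε))

<-trans-halves : ∀ {a b c ε} → a < b + halve ε → b < c + halve ε → a < c + ε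
<-trans-halves {a} {b} {c} {ε} p q =
  ℚ.<-trans p (subst (b + halve ε <_) regroup (ℚ.+-monoˡ-< (halve ε) q))
  where
  regroup : c + halve ε + halve ε ≡ c + ε
  regroup = trans (ℚ.+-assoc c (halve ε) (halve ε)) (cong (c +_) (halve+halve ε))

module _ {S : Set} where

  mass-++ : (d : S → ℚ) (xs ys : List S) → mass d (xs ++ ys) ≡ mass d xs + mass d ys
  mass-++ d []       ys = sym (ℚ.+-identityˡ _)
  mass-++ d (x ∷ xs) ys = trans (cong (d x +_) (mass-++ d xs ys)) (sym (ℚ.+-assoc (d x) _ _))

  mass-cong : ∀ {d d' : S → ℚ} → (∀ z → d z ≡ d' z) → ∀ xs → mass d xs ≡ mass d' xs
  mass-cong d≗d' xs = cong sumℚ (List.map-cong d≗d' xs)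

  mass-↭ : ∀ (d : S → ℚ) {xs ys} → xs ↭ ys → mass d xs ≡ mass d ys
  mass-↭ d xs↭ys = ↭ₛ.foldr-commMonoid (setoid ℚ) ℚ.+-0-isCommutativeMonoid (↭⇒↭ₛ (↭.map⁺ d xs↭ys))

  Unique-↭ : ∀ {xs ys : List S} → xs ↭ ys → Unique xs → Unique ys
  Unique-↭ xs↭ys = ↭ₛ.Unique-resp-↭ (setoid S) (↭⇒↭ₛ xs↭ys)

  Unique-++⁻ˡ : ∀ (xs : List S) {ys} → Unique (xs ++ ys) → Unique xs
  Unique-++⁻ˡ []       _            = []
  Unique-++⁻ˡ (x ∷ xs) (x∉ ∷ uniq) = All.++⁻ˡ xs x∉ ∷ Unique-++⁻ˡ xs uniq

  Unique-++⁻ʳ : ∀ (xs : List S) {ys} → Unique (xs ++ ys) → Unique ys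
  Unique-++⁻ʳ []       uniq       = uniq
  Unique-++⁻ʳ (x ∷ xs) (_ ∷ uniq) = Unique-++⁻ʳ xs uniq

  module _ {P : S → Set} where

    MassLE-refl : ∀ {d} → MassLE d d P
    MassLE-refl F sub ε ε>0 = F , sub , ≤⇒<+pos ℚ.≤-refl ε>0

    MassLE-trans : ∀ {d₁ d₂ d₃} → MassLE d₁ d₂ P → MassLE d₂ d₃ P → MassLE d₁ d₃ P
    MassLE-trans {d₂ = d₂} {d₃} le₁₂ le₂₃ F sub ε ε>0 with le₁₂ F sub (halve ε) (halve-pos ε>0)
    ... | G , subG , lt₁ with le₂₃ G subG (halve ε) (halve-pos ε>0)
    ... | H , subH , lt₂ = H , subH , <-trans-halves {b = mass d₂ G} {c = mass d₃ H} {ε = ε} lt₁ lt₂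

    MassLE-cong : ∀ {d₁ d₂ e₁ e₂} → (∀ z → d₁ z ≡ d₂ z) → (∀ z → e₁ z ≡ e₂ z) →
                  MassLE d₁ e₁ P → MassLE d₂ e₂ P
    MassLE-cong d₁≗d₂ e₁≗e₂ le F sub ε ε>0 with le F sub ε ε>0
    ... | G , subG , lt =
      G , subG , subst₂ _<_ (mass-cong d₁≗d₂ F) (cong (_+ ε) (mass-cong e₁≗e₂ G)) lt

    MassEq-refl : ∀ {d} → MassEq d d P
    MassEq-refl = MassLE-refl , MassLE-refl

    MassEq-trans : ∀ {d₁ d₂ d₃} → MassEq d₁ d₂ P → MassEq d₂ d₃ P → MassEq d₁ d₃ P
    MassEq-trans (le₁₂ , le₂₁) (le₂₃ , le₃₂) = MassLE-trans le₁₂ le₂₃ , MassLE-trans le₃₂ le₂₁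

    MassEq-cong : ∀ {d₁ d₂ e₁ e₂} → (∀ z → d₁ z ≡ d₂ z) → (∀ z → e₁ z ≡ e₂ z) →
                  MassEq d₁ e₁ P → MassEq d₂ e₂ P
    MassEq-cong d₁≗d₂ e₁≗e₂ (le , ge) = MassLE-cong d₁≗d₂ e₁≗e₂ le , MassLE-cong e₁≗e₂ d₁≗d₂ ge

-- R is not decidable, so a finite F cannot be split into its R-classes directly.  Instead F is cut into
-- blocks of R-related states; when the witness lists of two blocks overlap, their
-- representatives are R-related and the blocks are merged, until the witness lists are disjoint.
module Coarsening {S : Set} (_≟_ : DecidableEquality S) {R : Rel S 0ℓ} (R-equiv : IsEquivalence R)
                  {d d' : S → ℚ} (classwise : ∀ c → MassLE d d' (R c)) where
  open IsEquivalence R-equiv renaming (refl to R-refl; sym to R-sym; trans to R-trans)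
  open import Data.List.Membership.DecPropositional _≟_ using (_∈?_)

  Block : Set
  Block = S × List S

  Coherent : Block → Set
  Coherent (c , F) = All (R c) F

  flat : List Block → List S
  flat = concatMap proj₂

  InClassOf : List Block → S → Set
  InClassOf bs z = Any (λ b → R (proj₁ b) z) bs

  merge : ∀ {c} → List S → (bs : List Block) → InClassOf bs c → List Block
  merge F ((c' , F') ∷ bs) (here _) = (c' , F' ++ F) ∷ bs
  merge F (b ∷ bs)         (there m) = b ∷ merge F bs m

  module _ {c : S} (F : List S) where

    merge-length : ∀ bs (m : InClassOf bs c) → length (merge F bs m) ≡ length bs
    merge-length (_ ∷ bs) (here _)  = refl
    merge-length (b ∷ bs) (there m) = cong suc (merge-length bs m)

    merge-flat : ∀ bs (m : InClassOf bs c) → flat (merge F bs m) ↭ F ++ flat bs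
    merge-flat ((_ , F') ∷ bs) (here _) =
      ↭-trans (↭-reflexive (List.++-assoc F' F (flat bs))) (↭.shifts F' F)
    merge-flat ((_ , F') ∷ bs) (there m) =
      ↭-trans (↭.++⁺ˡ F' (merge-flat bs m)) (↭.shifts F' F)

    merge-coherent : ∀ {bs} (m : InClassOf bs c) → All (R c) F → All Coherent bs →
                     All Coherent (merge F bs m)
    merge-coherent (here Rc'c) RF (coh ∷ cohs) = All.++⁺ coh (All.map (R-trans Rc'c) RF) ∷ cohs
    merge-coherent (there m)   RF (coh ∷ cohs) = coh ∷ merge-coherent m RF cohs

    InClassOf-merge : ∀ {bs} (m : InClassOf bs c) {z} → InClassOf (merge F bs m) z → InClassOf bs z
    InClassOf-merge (here _)  (here Rz)  = here Rz
    InClassOf-merge (here _)  (there i)  = there i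
    InClassOf-merge (there m) (here Rz)  = here Rz
    InClassOf-merge (there m) (there i)  = there (InClassOf-merge m i)

  Matching : List Block → ℚ → Set
  Matching bs ε =
    Σ (List S) λ G → Unique G × All (InClassOf bs) G × mass d (flat bs) < mass d' G + ε

  match-blocks : ∀ n bs → length bs ≡ n → Unique (flat bs) → All Coherent bs →
                 ∀ ε → 0ℚ < ε → Matching bs ε
  match-blocks _ [] _ _ _ ε ε>0 = [] , [] , [] , subst (0ℚ <_) (sym (ℚ.+-identityˡ ε)) ε>0
  match-blocks (suc n) ((c , F) ∷ bs) len uniq (coh ∷ cohs) ε ε>0
    with match-blocks n bs (suc-injective len) (Unique-++⁻ʳ F uniq) cohs (halve ε) (halve-pos ε>0)
       | classwise c F (Unique-++⁻ˡ F uniq , coh) (halve ε) (halve-pos ε>0)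
  ... | Gs , uGs , inGs , ltGs | G , (uG , RG) , ltG with Any.any? (_∈? Gs) G
  ... | no disjoint =
    G ++ Gs , Unique.++⁺ uG uGs (λ (z∈G , z∈Gs) → disjoint (lose z∈G z∈Gs)) ,
    All.++⁺ (All.map here RG) (All.map there inGs) ,
    subst₂ _<_ (sym (mass-++ d F (flat bs))) (cong (_+ ε) (sym (mass-++ d' G Gs)))
      (+-mono-<-halves {b = mass d' G} {d = mass d' Gs} {ε = ε} ltG ltGs)
  ... | yes shared =
    let (z , z∈G , z∈Gs) = find shared
        m : InClassOf bs c
        m = Any.map (λ Rbz → R-trans Rbz (R-sym (All.lookup RG z∈G))) (All.lookup inGs z∈Gs)
        (G' , uG' , inG' , lt) =
          match-blocks n (merge F bs m) (trans (merge-length F bs m) (suc-injective len))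
                       (Unique-↭ (↭-sym (merge-flat F bs m)) uniq) (merge-coherent F m coh cohs)
                       ε ε>0
    in G' , uG' , All.map (there ∘′ InClassOf-merge F m) inG' ,
       subst (_< mass d' G' + ε) (mass-↭ d (merge-flat F bs m)) lt

  singletons : List S → List Block
  singletons = map (λ x → x , [ x ])

  flat-singletons : ∀ F → flat (singletons F) ≡ F
  flat-singletons []      = refl
  flat-singletons (x ∷ F) = cong (x ∷_) (flat-singletons F)

  MassLE-of-closed : ∀ (P : S → Set) → (∀ {x y} → P x → R x y → P y) → MassLE d d' P
  MassLE-of-closed P closed F (uF , PF) ε ε>0 =
    let (G , uG , inG , lt) = match-blocks _ (singletons F) refl
                                (subst Unique (sym (flat-singletons F)) uF)
                                (All.map⁺ (All.universal (λ _ → R-refl ∷ []) F)) ε ε>0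
    in G , (uG , All.map inP inG) , subst (λ xs → mass d xs < mass d' G + ε) (flat-singletons F) lt
    where
    inP : ∀ {z} → InClassOf (singletons F) z → P z
    inP i = let (Px , Rxz) = All.lookupAny PF (Any.map⁻ i) in closed Px Rxz

module _ (P : pLTS) where
  open pLTS P

  private
    code : State → ℕ
    code = Injection.to countable

  _≟_ : DecidableEquality State
  x ≟ y = Dec.map′ (Injection.injective countable) (cong code) (code x ℕ.≟ code y)

  open import Data.List.Membership.DecPropositional _≟_ using (_∈?_)

  -- The point mass ½ at x from which half is built (the one in Defs is private).
  δ : State → State → ℚ
  δ x z with code z ℕ.≟ code x
  ... | yes _ = ½
  ... | no  _ = 0ℚ

  half-δ : ∀ x y z → half x y z ≡ δ x z + δ y z
  half-δ x y z with code z ℕ.≟ code x | code z ℕ.≟ code y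
  ... | yes _ | yes _ = refl
  ... | yes _ | no  _ = refl
  ... | no  _ | yes _ = refl
  ... | no  _ | no  _ = refl

  δ-self : ∀ x → δ x x ≡ ½
  δ-self x with code x ℕ.≟ code x
  ... | yes _      = refl
  ... | no  cx≢cx = ⊥-elim (cx≢cx refl)

  δ-≢ : ∀ {x z} → z ≢ x → δ x z ≡ 0ℚ
  δ-≢ {x} {z} z≢x with code z ℕ.≟ code x
  ... | yes cz≡cx = ⊥-elim (z≢x (Injection.injective countable cz≡cx))
  ... | no  _     = refl

  mass-half : ∀ x y G → mass (half x y) G ≡ mass (δ x) G + mass (δ y) G
  mass-half x y []      = refl
  mass-half x y (z ∷ G) =
    trans (cong₂ _+_ (half-δ x y z) (mass-half x y G)) (interchange (δ x z) (δ y z) _ _)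

  mass-δ-∉ : ∀ {x G} → x ∉ G → mass (δ x) G ≡ 0ℚ
  mass-δ-∉ {G = []}    _   = refl
  mass-δ-∉ {G = z ∷ G} x∉ =
    trans (cong₂ _+_ (δ-≢ (λ z≡x → x∉ (here (sym z≡x)))) (mass-δ-∉ (x∉ ∘′ there)))
          (ℚ.+-identityˡ 0ℚ)

  mass-δ-∈ : ∀ {x G} → Unique G → x ∈ G → mass (δ x) G ≡ ½
  mass-δ-∈ {x} uG@(_ ∷ _) (here refl) =
    trans (cong₂ _+_ (δ-self x) (mass-δ-∉ (Unique.Unique[x∷xs]⇒x∉xs uG))) (ℚ.+-identityʳ ½)
  mass-δ-∈ {x} {z ∷ G} uG@(_ ∷ uG') (there x∈G) =
    trans (cong₂ _+_ (δ-≢ z≢x) (mass-δ-∈ uG' x∈G)) (ℚ.+-identityˡ ½)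
    where
    z≢x : z ≢ x
    z≢x z≡x = Unique.Unique[x∷xs]⇒x∉xs uG (subst (_∈ G) (sym z≡x) x∈G)

  0<½ : 0ℚ < ½
  0<½ = ℚ.positive⁻¹ ½

  mass-δ-≤-½ : ∀ {x G} → Unique G → mass (δ x) G ≤ ½
  mass-δ-≤-½ {x} {G} uG with x ∈? G
  ... | yes x∈G = ℚ.≤-reflexive (mass-δ-∈ uG x∈G)
  ... | no  x∉G = subst (_≤ ½) (sym (mass-δ-∉ x∉G)) (ℚ.<⇒≤ 0<½)

  mass-δ-nonneg : ∀ {x G} → Unique G → 0ℚ ≤ mass (δ x) G
  mass-δ-nonneg {x} {G} uG with x ∈? G
  ... | yes x∈G = subst (0ℚ ≤_) (sym (mass-δ-∈ uG x∈G)) (ℚ.<⇒≤ 0<½)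
  ... | no  x∉G = ℚ.≤-reflexive (sym (mass-δ-∉ x∉G))

  mass-δ-mono : ∀ {x y F G} → Unique F → Unique G → (x ∈ F → y ∈ G) → mass (δ x) F ≤ mass (δ y) G
  mass-δ-mono {x} {y} {F} uF uG x∈F⇒y∈G with x ∈? F
  ... | yes x∈F = ℚ.≤-reflexive (trans (mass-δ-∈ uF x∈F) (sym (mass-δ-∈ uG (x∈F⇒y∈G x∈F))))
  ... | no  x∉F = subst (_≤ _) (sym (mass-δ-∉ x∉F)) (mass-δ-nonneg uG)

  mass-half-mono : ∀ {x₁ x₂ y₁ y₂ F G} → Unique F → Unique G →
                   (x₁ ∈ F → y₁ ∈ G) → (x₂ ∈ F → y₂ ∈ G) → mass (half x₁ x₂) F ≤ mass (half y₁ y₂) G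
  mass-half-mono {x₁} {x₂} {y₁} {y₂} {F} {G} uF uG x₁⇒y₁ x₂⇒y₂ =
    subst₂ _≤_ (sym (mass-half x₁ x₂ F)) (sym (mass-half y₁ y₂ G))
      (ℚ.+-mono-≤ (mass-δ-mono uF uG x₁⇒y₁) (mass-δ-mono uF uG x₂⇒y₂))

  ½≤mass-half : ∀ {x y F} → Unique F → x ∈ F → ½ ≤ mass (half x y) F
  ½≤mass-half {x} {y} {F} uF x∈F =
    subst₂ _≤_ (ℚ.+-identityʳ ½) (sym (trans (mass-half x y F) (cong (_+ _) (mass-δ-∈ uF x∈F))))
      (ℚ.+-monoʳ-≤ ½ (mass-δ-nonneg uF))

  mass-half-≡-1 : ∀ {x y F} → Unique F → x ∈ F → y ∈ F → mass (half x y) F ≡ 1ℚ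
  mass-half-≡-1 {x} {y} {F} uF x∈F y∈F =
    trans (mass-half x y F) (cong₂ _+_ (mass-δ-∈ uF x∈F) (mass-δ-∈ uF y∈F))

  module _ {Q : State → Set} {d : State → ℚ} {c c' : State} (le : MassLE d (half c c') Q) where

    MassLE-half-reaches : ∀ {F} → FinSub Q F → ½ ≤ mass d F → Q c ⊎ Q c'
    MassLE-half-reaches {F} sub ½≤dF with le F sub ½ 0<½
    ... | G , (uG , QG) , lt with c ∈? G | c' ∈? G
    ... | yes c∈G | _        = inj₁ (All.lookup QG c∈G)
    ... | no  _   | yes c'∈G = inj₂ (All.lookup QG c'∈G)
    ... | no  c∉G | no  c'∉G =
      ⊥-elim (ℚ.<-irrefl refl (ℚ.≤-<-trans ½≤dF (subst (mass d F <_) missed lt)))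
      where
      missed : mass (half c c') G + ½ ≡ ½
      missed = cong (_+ ½) (trans (mass-half c c' G) (cong₂ _+_ (mass-δ-∉ c∉G) (mass-δ-∉ c'∉G)))

    MassLE-half-reachesˡ : ∀ {F} → FinSub Q F → 1ℚ ≤ mass d F → Q c
    MassLE-half-reachesˡ {F} sub 1≤dF with le F sub ½ 0<½
    ... | G , (uG , QG) , lt with c ∈? G
    ... | yes c∈G = All.lookup QG c∈G
    ... | no  c∉G =
      ⊥-elim (ℚ.<-irrefl refl (ℚ.≤-<-trans 1≤dF (ℚ.<-≤-trans lt (ℚ.+-monoˡ-≤ ½ half-missed))))
      where
      half-missed : mass (half c c') G ≤ ½
      half-missed = subst (_≤ ½)
        (sym (trans (mass-half c c' G) (trans (cong (_+ _) (mass-δ-∉ c∉G)) (ℚ.+-identityˡ _))))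
        (mass-δ-≤-½ uG)

  module _ {R : Rel State 0ℓ} (R-equiv : IsEquivalence R) where
    open IsEquivalence R-equiv using () renaming (refl to R-refl)

    class-reaches : ∀ {x y c c'} → MassLE (half x y) (half c c') (R x) → R x c ⊎ R x c'
    class-reaches le =
      MassLE-half-reaches le (([] ∷ []) , R-refl ∷ []) (½≤mass-half ([] ∷ []) (here refl))

    class-reaches-shared : ∀ {x y c} → MassLE (half x y) (half c y) (R x) → R x c
    class-reaches-shared {x} {y} le with class-reaches le
    ... | inj₁ Rxc = Rxc
    ... | inj₂ Rxy =
      MassLE-half-reachesˡ le (uF , All.deduplicate⁺ _≟_ (R-refl ∷ Rxy ∷ []))
        (ℚ.≤-reflexive (sym (mass-half-≡-1 uF (∈-pair (here refl)) (∈-pair (there (here refl))))))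
      where
      pair : List State
      pair = x ∷ y ∷ []
      uF : Unique (deduplicate _≟_ pair)
      uF = UniqueDec.deduplicate-! _≟_ pair
      ∈-pair : ∀ {z} → z ∈ pair → z ∈ deduplicate _≟_ pair
      ∈-pair = ∈-deduplicate⁺ _≟_

  select : ∀ {Q : State → Set} {p q} F → All Q F → (Q p → Q q) →
           Σ (List State) λ G → All Q G × (p ∈ F → q ∈ G)
  select {p = p} {q} F QF Qp⇒Qq with p ∈? F
  ... | yes p∈F = [ q ] , Qp⇒Qq (All.lookup QF p∈F) ∷ [] , λ _ → here refl
  ... | no  p∉F = [] , [] , λ p∈F → ⊥-elim (p∉F p∈F)

  half-MassLE : ∀ {Q : State → Set} {p₁ p₂ q₁ q₂} → (Q p₁ → Q q₁) → (Q p₂ → Q q₂) →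
                MassLE (half p₁ p₂) (half q₁ q₂) Q
  half-MassLE Q₁ Q₂ F (uF , QF) ε ε>0 =
    let (G₁ , QG₁ , p₁⇒q₁) = select F QF Q₁
        (G₂ , QG₂ , p₂⇒q₂) = select F QF Q₂
        uG = UniqueDec.deduplicate-! _≟_ (G₁ ++ G₂)
    in deduplicate _≟_ (G₁ ++ G₂) , (uG , All.deduplicate⁺ _≟_ (All.++⁺ QG₁ QG₂)) ,
       ≤⇒<+pos (mass-half-mono uF uG (∈-deduplicate⁺ _≟_ ∘′ ∈-++⁺ˡ ∘′ p₁⇒q₁)
                                     (∈-deduplicate⁺ _≟_ ∘′ ∈-++⁺ʳ G₁ ∘′ p₂⇒q₂)) ε>0

  OnlyStep-step : ∀ {p a x y} → OnlyStep p a x y → p ⟶[ a ] half x y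
  OnlyStep-step p-step = proj₂ (p-step _ _) (refl , λ _ → refl)

  OnlyStep-comm : ∀ {p a x y} → OnlyStep p a x y → OnlyStep p a y x
  OnlyStep-comm p-step b d =
    (λ p→d → let (b≡a , d≗) = proj₁ (p-step b d) p→d in b≡a , λ z → trans (d≗ z) (half-comm z))
    , λ (b≡a , d≗) → proj₂ (p-step b d) (b≡a , λ z → trans (d≗ z) (half-comm z))
    where
    half-comm : ∀ {x y} z → half x y z ≡ half y x z
    half-comm {x} {y} z =
      trans (half-δ x y z) (trans (ℚ.+-comm (δ x z) (δ y z)) (sym (half-δ y x z)))

  IsBisimulation⇒half-MassLE : ∀ {R p q a x y x' y'} → IsBisimulation R → R p q →
                               OnlyStep p a x y → OnlyStep q a x' y' →
                               ∀ e → MassLE (half x y) (half x' y') (R e)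
  IsBisimulation⇒half-MassLE (_ , transfer) Rpq p-step q-step e
    with transfer Rpq (OnlyStep-step p-step)
  ... | d' , q→d' , meq = MassLE-cong (λ _ → refl) (proj₂ (proj₁ (q-step _ _) q→d')) (proj₁ (meq e))

  module BisimulationClosure {R : Rel State 0ℓ} (R-bisim : IsBisimulation R) (Gen : Rel State 0ℓ)
    where
    open IsEquivalence (proj₁ R-bisim) using () renaming (sym to R-sym)

    _≈_ : Rel State 0ℓ
    _≈_ = EqClosure (R ∪ Gen)

    open IsEquivalence (EqClosure.isEquivalence (R ∪ Gen)) public
      using () renaming (refl to ≈-refl; sym to ≈-sym; trans to ≈-trans)

    R⇒≈ : ∀ {x y} → R x y → x ≈ y
    R⇒≈ = return ∘′ fwd ∘′ inj₁

    Gen⇒≈ : ∀ {x y} → Gen x y → x ≈ y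
    Gen⇒≈ = return ∘′ fwd ∘′ inj₂

    Answers : Rel State 0ℓ
    Answers x y = ∀ {b d} → x ⟶[ b ] d →
                  Σ (State → ℚ) λ d' → (y ⟶[ b ] d') × (∀ e → MassEq d d' (e ≈_))

    Answers-refl : ∀ {x} → Answers x x
    Answers-refl x→d = _ , x→d , λ _ → MassEq-refl

    Answers-trans : ∀ {x y z} → Answers x y → Answers y z → Answers x z
    Answers-trans xy yz x→d with xy x→d
    ... | d' , y→d' , meq₁ with yz y→d'
    ... | d'' , z→d'' , meq₂ = d'' , z→d'' , λ e → MassEq-trans (meq₁ e) (meq₂ e)

    R⇒Answers : ∀ {x y} → R x y → Answers x y
    R⇒Answers Rxy x→d with proj₂ R-bisim Rxy x→d
    ... | d' , y→d' , meq =
      d' , y→d' , λ e → coarsen (λ c → proj₁ (meq c)) e , coarsen (λ c → proj₂ (meq c)) e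
      where
      coarsen : ∀ {d₁ d₂} → (∀ c → MassLE d₁ d₂ (R c)) → ∀ e → MassLE d₁ d₂ (e ≈_)
      coarsen classwise e = Coarsening.MassLE-of-closed _≟_ (proj₁ R-bisim) classwise (e ≈_)
                              (λ e≈x Rxy → ≈-trans e≈x (R⇒≈ Rxy))

    Answers-half : ∀ {p q a x y x' y'} → OnlyStep p a x y → OnlyStep q a x' y' →
                   x ≈ x' → y ≈ y' → Answers p q
    Answers-half {x' = x'} {y'} p-step q-step x≈x' y≈y' p→d with proj₁ (p-step _ _) p→d
    ... | refl , d≗ = half x' y' , OnlyStep-step q-step , λ e →
      MassEq-cong (λ z → sym (d≗ z)) (λ _ → refl)
        ( half-MassLE (λ e≈x → ≈-trans e≈x x≈x') (λ e≈y → ≈-trans e≈y y≈y')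
        , half-MassLE (λ e≈x' → ≈-trans e≈x' (≈-sym x≈x')) (λ e≈y' → ≈-trans e≈y' (≈-sym y≈y')))

    Mutual : Rel State 0ℓ
    Mutual x y = Answers x y × Answers y x

    Mutual-half : ∀ {p q a x y x' y'} → OnlyStep p a x y → OnlyStep q a x' y' →
                  x ≈ x' → y ≈ y' → Mutual p q
    Mutual-half p-step q-step x≈x' y≈y' =
      Answers-half p-step q-step x≈x' y≈y' , Answers-half q-step p-step (≈-sym x≈x') (≈-sym y≈y')

    Mutual-equiv : IsEquivalence Mutual
    Mutual-equiv = record
      { refl  = Answers-refl , Answers-refl
      ; sym   = λ (xy , yx) → yx , xy
      ; trans = λ (xy , yx) (yz , zy) → Answers-trans xy yz , Answers-trans zy yx
      }

    ≈-isBisimulation : (∀ {x y} → Gen x y → Mutual x y) → IsBisimulation _≈_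
    ≈-isBisimulation Gen⇒Mutual =
      EqClosure.isEquivalence (R ∪ Gen) , λ x≈y → proj₁ (EqClosure.fold Mutual-equiv generator x≈y)
      where
      generator : ∀ {x y} → (R ∪ Gen) x y → Mutual x y
      generator (inj₁ Rxy) = R⇒Answers Rxy , R⇒Answers (R-sym Rxy)
      generator (inj₂ g)   = Gen⇒Mutual g

  module Square (a : Act) (s s' t₁ t₁' t₂ t₂' u₁₂ u₁'₂ u₁₂' u₁'₂' : State)
    (s-step : OnlyStep s a u₁₂ u₁'₂') (s'-step : OnlyStep s' a u₁₂' u₁'₂)
    (u₁₂-step : OnlyStep u₁₂ a t₁ t₂) (u₁'₂'-step : OnlyStep u₁'₂' a t₁' t₂')
    (u₁₂'-step : OnlyStep u₁₂' a t₁ t₂') (u₁'₂-step : OnlyStep u₁'₂ a t₁' t₂) where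

    ∼-split : s ∼ s' → (t₁ ∼ t₁') ⊎ (t₂ ∼ t₂')
    ∼-split (R , R-bisim , Rss')
      with class-reaches (proj₁ R-bisim) (IsBisimulation⇒half-MassLE R-bisim Rss' s-step s'-step u₁₂)
    ... | inj₁ Ru₁₂u₁₂' = inj₂ (R , R-bisim , class-reaches-shared (proj₁ R-bisim)
            (IsBisimulation⇒half-MassLE R-bisim Ru₁₂u₁₂'
               (OnlyStep-comm u₁₂-step) (OnlyStep-comm u₁₂'-step) t₂))
    ... | inj₂ Ru₁₂u₁'₂ = inj₁ (R , R-bisim , class-reaches-shared (proj₁ R-bisim)
            (IsBisimulation⇒half-MassLE R-bisim Ru₁₂u₁'₂ u₁₂-step u₁'₂-step t₁))

    data Gen : Rel State 0ℓ where
      s-s'       : Gen s s'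
      u₁₂-u₁'₂   : Gen u₁₂ u₁'₂
      u₁'₂'-u₁₂' : Gen u₁'₂' u₁₂'

    ∼-of-∼₁ : t₁ ∼ t₁' → s ∼ s'
    ∼-of-∼₁ (R , R-bisim , Rt₁t₁') = _≈_ , ≈-isBisimulation Gen⇒Mutual , Gen⇒≈ s-s'
      where
      open BisimulationClosure R-bisim Gen
      open IsEquivalence (proj₁ R-bisim) using () renaming (sym to R-sym)

      Gen⇒Mutual : ∀ {x y} → Gen x y → Mutual x y
      Gen⇒Mutual s-s'       =
        Mutual-half s-step (OnlyStep-comm s'-step) (Gen⇒≈ u₁₂-u₁'₂) (Gen⇒≈ u₁'₂'-u₁₂')
      Gen⇒Mutual u₁₂-u₁'₂   = Mutual-half u₁₂-step u₁'₂-step (R⇒≈ Rt₁t₁') ≈-refl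
      Gen⇒Mutual u₁'₂'-u₁₂' = Mutual-half u₁'₂'-step u₁₂'-step (R⇒≈ (R-sym Rt₁t₁')) ≈-refl

proposition5p3 : (P : pLTS) → let open pLTS P in
    (a : Act) (s s' t₁ t₁' t₂ t₂' u₁₂ u₁'₂ u₁₂' u₁'₂' : State) →
    OnlyStep s a u₁₂ u₁'₂' →
    OnlyStep s' a u₁₂' u₁'₂ →
    OnlyStep u₁₂ a t₁ t₂ →
    OnlyStep u₁'₂' a t₁' t₂' →
    OnlyStep u₁₂' a t₁ t₂' →
    OnlyStep u₁'₂ a t₁' t₂ →
    (s ∼ s') ⇔ ((t₁ ∼ t₁') ⊎ (t₂ ∼ t₂'))
proposition5p3 P a s s' t₁ t₁' t₂ t₂' u₁₂ u₁'₂ u₁₂' u₁'₂'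
               s-step s'-step u₁₂-step u₁'₂'-step u₁₂'-step u₁'₂-step =
  mk⇔ ∼-split join
  where
  open pLTS P
  open Square P a s s' t₁ t₁' t₂ t₂' u₁₂ u₁'₂ u₁₂' u₁'₂'
              s-step s'-step u₁₂-step u₁'₂'-step u₁₂'-step u₁'₂-step

  join : (t₁ ∼ t₁') ⊎ (t₂ ∼ t₂') → s ∼ s'
  join (inj₁ t₁∼t₁') = ∼-of-∼₁ t₁∼t₁'
  -- exchanging the indices 1 and 2 maps the square onto itself
  join (inj₂ t₂∼t₂') =
    Square.∼-of-∼₁ P a s s' t₂ t₂' t₁ t₁' u₁₂ u₁₂' u₁'₂ u₁'₂'
      s-step (OnlyStep-comm P s'-step) (OnlyStep-comm P u₁₂-step) (OnlyStep-comm P u₁'₂'-step)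
      (OnlyStep-comm P u₁'₂-step) (OnlyStep-comm P u₁₂'-step) t₂∼t₂'
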